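{- Let $f$ be an $n$-ary polynomial of degree $d$ over the finite field $\mathbb F_q$. Then for every $y\in\mathbb F_q$ such that $|f^{ -1}(y)|>0$ we have $|f^{ -1}(y)|\ge q^{\,n-d-q\log_2 q}$.
   Context: $f$ is regarded as a function $\mathbb F_q^n\to\mathbb F_q$ and $f^{ -1}(y)=\{\bar a\in\mathbb F_q^n: f(\bar a)=y\}$. -}

module Defs where

open import Level using (0ℓ)
open import Data.Nat as ℕ using (ℕ; zero; suc)
open import Data.Fin using (Fin)
open import Data.Product using (_×_; _,_; Σ; ∃)
open import Data.List as List using (List; []; _∷_; length; filter; concatMap; map)
open import Data.Vec as Vec using (Vec; []; _∷_)
import Data.Vec.Properties as VecP
open import Relation.Nullary using (¬_; Dec; does)
open import Relation.Binary.PropositionalEquality using (_≡_)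
open import Relation.Binary.Definitions using (DecidableEquality)
open import Algebra.Structures using (IsCommutativeRing)
open import Function.Bundles using (_↔_; Inverse)
open import Data.Bool using (if_then_else_)

record FiniteField (q : ℕ) : Set₁ where
  infixl 6 _+_
  infixl 7 _*_
  field
    Carrier : Set
    _+_ _*_ : Carrier → Carrier → Carrier
    -_      : Carrier → Carrier
    0# 1#   : Carrier
    isCommutativeRing : IsCommutativeRing _≡_ _+_ _*_ -_ 0# 1#
    1≢0     : ¬ (1# ≡ 0#)
    inverse : ∀ x → ¬ (x ≡ 0#) → Σ Carrier λ y → x * y ≡ 1#
    _≟_     : DecidableEquality Carrier
    enum    : Fin q ↔ Carrier

  elements : List Carrier
  elements = List.map (Inverse.to enum) (List.allFin q)

  points : (n : ℕ) → List (Vec Carrier n)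
  points zero    = [] ∷ []
  points (suc n) = concatMap (λ x → map (x ∷_) (points n)) elements

  _^_ : Carrier → ℕ → Carrier
  x ^ zero  = 1#
  x ^ suc k = x * (x ^ k)

  -- an n-ary polynomial: a finite formal sum of terms  c · x₁^e₁ ⋯ xₙ^eₙ,
  -- a term being a coefficient together with an exponent vector
  Poly : ℕ → Set
  Poly n = List (Carrier × Vec ℕ n)

  monomial : ∀ {n} → Vec ℕ n → Vec Carrier n → Carrier
  monomial []       []       = 1#
  monomial (e ∷ es) (a ∷ as) = (a ^ e) * monomial es as

  eval : ∀ {n} → Poly n → Vec Carrier n → Carrier
  eval []             a = 0#
  eval ((c , e) ∷ ts) a = c * monomial e a + eval ts a

  coeff : ∀ {n} → Poly n → Vec ℕ n → Carrier
  coeff []             m = 0#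
  coeff ((c , e) ∷ ts) m =
    if does (VecP.≡-dec ℕ._≟_ e m) then c + coeff ts m else coeff ts m

  totalDeg : ∀ {n} → Vec ℕ n → ℕ
  totalDeg = Vec.sum

  HasDegree : ∀ {n} → Poly n → ℕ → Set
  HasDegree {n} f d =
    (∀ (m : Vec ℕ n) → ¬ (coeff f m ≡ 0#) → totalDeg m ℕ.≤ d)
    × (∃ λ (m : Vec ℕ n) → totalDeg m ≡ d × ¬ (coeff f m ≡ 0#))

  preimageSize : ∀ {n} → Poly n → Carrier → ℕ
  preimageSize {n} f y = length (filter (λ a → eval f a ≟ y) (points n))

{-# OPTIONS --safe #-}

-- By Fermat's little theorem, g = 1 - (f - y)^(q-1) is the indicator function of f⁻¹(y), of degree at
-- most (q-1)d. The core is a lower bound for the number N of points where a polynomial p of degree at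
-- most D, not identically zero, does not vanish:  N^(q-1) q^D ≥ q^((q-1)n).  By induction on n: with all
-- exponents reduced below q, write p = Σ_{j<q} x₀^j P_j(x') and let P_k be the last slice that is not
-- identically zero. It has degree at most D - k, and wherever P_k(x') ≠ 0 the univariate polynomial
-- p(·, x') has degree k, hence at least q - k non-roots; so N ≥ (q - k) N(P_k), and the estimate
-- q^(q-1) ≤ (q-k)^(q-1) q^k closes the induction. For g this gives |f⁻¹(y)| ≥ q^(n-d) (Warning's second
-- theorem).

module Submission where

open import Defs
open import Data.Nat using (ℕ; _+_; _*_; _^_; _≤_; _<_)

open import Level using (0ℓ)
open import Algebra.Bundles using (CommutativeRing)
open import Data.Bool using (Bool; true; false)
open import Data.Fin using (Fin)
open import Data.List using (List; []; _∷_; _++_; [_]; length; map; concatMap; filter; foldr; replicate; allFin)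
open import Data.List.Properties using (length-map; length-tabulate; length-replicate; length-++; map-cong; filter-notAll)
open import Data.List.Membership.Propositional using (_∈_; lose)
open import Data.List.Membership.Propositional.Properties using (∈-map⁺; ∈-map⁻; ∈-filter⁺; ∈-filter⁻; ∈-allFin; ∈-concat⁺′)
open import Data.List.Membership.Propositional.Properties.WithK using (unique∧set⇒bag)
open import Data.List.Relation.Binary.BagAndSetEquality using (∼bag⇒↭)
open import Data.List.Relation.Binary.Permutation.Propositional using (_↭_; ↭⇒↭ₛ)
open import Data.List.Relation.Binary.Permutation.Setoid.Properties using (foldr-commMonoid)
open import Data.List.Relation.Unary.All as All using (All; []; _∷_)
open import Data.List.Relation.Unary.All.Properties using (++⁺; map⁺; all-filter)
open import Data.List.Relation.Unary.AllPairs using (_∷_)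
open import Data.List.Relation.Unary.Any using (here; there; any?; satisfied)
open import Data.List.Relation.Unary.Unique.Propositional using (Unique)
import Data.List.Relation.Unary.Unique.Propositional.Properties as Unique
open import Data.Maybe using (nothing)
open import Data.Nat as ℕ using (zero; suc; pred; _∸_; _≤?_; z≤n; s≤s; NonZero; >-nonZero; >-nonZero⁻¹)
open import Data.Nat.DivMod using (_%_; _/_; m≡m%n+[m/n]*n; m%n<n; m%n≤m)
open import Data.Nat.Induction using (<-wellFounded)
open import Data.Nat.ListAction using (sum)
open import Data.Nat.Properties
  using (≤-refl; ≤-reflexive; ≤-trans; ≤-antisym; <⇒≤; <⇒≱; ≰⇒>; n≤1+n; m≤n+m; m<m+n; m≤n⇒m≤1+n;
         +-assoc; +-comm; +-identityʳ; +-suc; +-mono-≤; +-monoˡ-≤; +-monoʳ-≤;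
         *-comm; *-assoc; *-suc; *-zeroʳ; *-identityˡ; *-identityʳ; *-distribˡ-+; *-mono-≤; *-monoˡ-≤; *-monoʳ-≤;
         m≤m*n; ^-distribˡ-+-*; ^-*-assoc; ^-zeroˡ; ^-monoˡ-≤; ^-monoˡ-<; m^n>0; m^n≢0;
         m+n∸m≡n; m+[n∸m]≡n; m∸n≤m; ∸-monoˡ-≤; pred[m∸n]≡m∸[1+n]; pred-mono-≤; suc-pred; suc-injective;
         m+n≤o⇒m≤o; m+n≤o⇒m≤o∸n; m≤n⇒∃[o]m+o≡n; module ≤-Reasoning)
open import Data.Nat.Tactic.RingSolver using (solve-∀)
open import Data.Product using (Σ; ∃; _×_; _,_; proj₁; proj₂)
open import Data.Sum using (_⊎_; inj₁; inj₂)
open import Data.Unit using (⊤; tt)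
open import Data.Vec as Vec using (Vec; []; _∷_; zipWith)
open import Data.Vec.Properties using (≡-dec)
open import Function using (_∘_; _on_; Inverse)
open import Function.Bundles using (mk⇔)
open import Induction.WellFounded using (Acc; acc)
open import Relation.Binary.Construct.On using (wellFounded)
open import Relation.Nullary using (¬_; Dec; yes; no; does; ¬?; contradiction)
open import Relation.Nullary.Decidable using (dec-true; dec-false)
open import Relation.Unary using (Decidable)
open import Relation.Binary.PropositionalEquality using (_≡_; _≢_; refl; sym; trans; cong; cong₂; subst; module ≡-Reasoning)

indicator : Bool → ℕ
indicator false = 0
indicator true  = 1

module _ {A : Set} where

  count : (A → Bool) → List A → ℕ
  count p []       = 0
  count p (x ∷ xs) = indicator (p x) + count p xs

  length-filter≡count : ∀ {P : A → Set} (P? : Decidable P) xs →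
                        length (filter P? xs) ≡ count (does ∘ P?) xs
  length-filter≡count P? []       = refl
  length-filter≡count P? (x ∷ xs) with does (P? x)
  ... | true  = cong suc (length-filter≡count P? xs)
  ... | false = length-filter≡count P? xs

  count-cong : ∀ {p p′ : A → Bool} → (∀ x → p x ≡ p′ x) → ∀ xs → count p xs ≡ count p′ xs
  count-cong p≗p′ []       = refl
  count-cong p≗p′ (x ∷ xs) = cong₂ _+_ (cong indicator (p≗p′ x)) (count-cong p≗p′ xs)

  count-++ : ∀ p xs ys → count p (xs ++ ys) ≡ count p xs + count p ys
  count-++ p []       ys = refl
  count-++ p (x ∷ xs) ys = trans (cong (indicator (p x) +_) (count-++ p xs ys))
                                 (sym (+-assoc (indicator (p x)) _ _))

  count-all : ∀ {p} → (∀ x → p x ≡ true) → ∀ xs → count p xs ≡ length xs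
  count-all p≡true []       = refl
  count-all p≡true (x ∷ xs) rewrite p≡true x = cong suc (count-all p≡true xs)

  count<length : ∀ {p x xs} → x ∈ xs → p x ≡ false → count p xs < length xs
  count<length {p} {xs = y ∷ ys} (here refl) px≡false rewrite px≡false =
    s≤s (count≤length ys)
    where
    count≤length : ∀ ys → count p ys ≤ length ys
    count≤length []       = z≤n
    count≤length (y ∷ ys) with p y
    ... | true  = s≤s (count≤length ys)
    ... | false = m≤n⇒m≤1+n (count≤length ys)
  count<length {p} {xs = y ∷ ys} (there x∈ys) px≡false with p y
  ... | true  = s≤s (count<length x∈ys px≡false)
  ... | false = m≤n⇒m≤1+n (count<length x∈ys px≡false)

  count>0⇒∃ : ∀ p xs → 0 < count p xs → ∃ λ x → p x ≡ true
  count>0⇒∃ p (x ∷ xs) count>0 with p x in px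
  ... | true  = x , px
  ... | false = count>0⇒∃ p xs count>0

  count-≤-suc : ∀ {p p′} r → (∀ x → p x ≡ true → x ≡ r ⊎ p′ x ≡ true) →
                ∀ {xs} → Unique xs → count p xs ≤ suc (count p′ xs)
  count-≤-suc r cover {[]} _ = z≤n
  count-≤-suc {p} {p′} r cover {x ∷ xs} (x∉xs ∷ unique) with p x in px
  ... | false = ≤-trans (count-≤-suc r cover unique) (s≤s (m≤n+m _ (indicator (p′ x))))
  ... | true with cover x px
  ...   | inj₂ p′x rewrite p′x = s≤s (count-≤-suc r cover unique)
  ...   | inj₁ refl = s≤s (≤-trans (count-mono xs x∉xs) (m≤n+m _ (indicator (p′ x))))
    where
    count-mono : ∀ ys → All (x ≢_) ys → count p ys ≤ count p′ ys
    count-mono []       []            = z≤n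
    count-mono (y ∷ ys) (x≢y ∷ x∉ys) with p y in py
    ... | false = ≤-trans (count-mono ys x∉ys) (m≤n+m _ (indicator (p′ y)))
    ... | true with cover y py
    ...   | inj₁ y≡x = contradiction (sym y≡x) x≢y
    ...   | inj₂ p′y rewrite p′y = s≤s (count-mono ys x∉ys)

  *-count≤sum : ∀ c p (f : A → ℕ) → (∀ x → c * indicator (p x) ≤ f x) →
                ∀ xs → c * count p xs ≤ sum (map f xs)
  *-count≤sum c p f bound []       = ≤-reflexive (*-zeroʳ c)
  *-count≤sum c p f bound (x ∷ xs) = begin
    c * (indicator (p x) + count p xs)      ≡⟨ *-distribˡ-+ c (indicator (p x)) (count p xs) ⟩
    c * indicator (p x) + c * count p xs    ≤⟨ +-mono-≤ (bound x) (*-count≤sum c p f bound xs) ⟩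
    f x + sum (map f xs)                    ∎
    where open ≤-Reasoning

module _ {A B : Set} where

  count-map : ∀ p (f : A → B) xs → count p (map f xs) ≡ count (p ∘ f) xs
  count-map p f []       = refl
  count-map p f (x ∷ xs) = cong (indicator (p (f x)) +_) (count-map p f xs)

  count-concatMap : ∀ p (f : A → List B) xs →
                    count p (concatMap f xs) ≡ sum (map (count p ∘ f) xs)
  count-concatMap p f []       = refl
  count-concatMap p f (x ∷ xs) = trans (count-++ p (f x) (concatMap f xs))
                                       (cong (count p (f x) +_) (count-concatMap p f xs))

  sum-count-comm : ∀ (r : A → B → Bool) xs ys →
                   sum (map (λ x → count (r x) ys) xs) ≡ sum (map (λ y → count (λ x → r x y) xs) ys)
  sum-count-comm r []       ys = sym (sum-zeros ys)
    where
    sum-zeros : ∀ (ys : List B) → sum (map (λ _ → 0) ys) ≡ 0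
    sum-zeros []       = refl
    sum-zeros (_ ∷ ys) = sum-zeros ys
  sum-count-comm r (x ∷ xs) ys = trans (cong (count (r x) ys +_) (sum-count-comm r xs ys)) (merge ys)
    where
    merge : ∀ ys → count (r x) ys + sum (map (λ y → count (λ x → r x y) xs) ys)
                   ≡ sum (map (λ y → count (λ x → r x y) (x ∷ xs)) ys)
    merge []       = refl
    merge (y ∷ ys) = trans (interchange (indicator (r x y)) (count (r x) ys) (count (λ x → r x y) xs) _)
                           (cong (indicator (r x y) + count (λ x → r x y) xs +_) (merge ys))
      where
      interchange : ∀ a b c d → a + b + (c + d) ≡ a + c + (b + d)
      interchange = solve-∀

^-distribʳ-* : ∀ m n o → (m * n) ^ o ≡ m ^ o * n ^ o
^-distribʳ-* m n zero    = refl
^-distribʳ-* m n (suc o) = trans (cong (m * n *_) (^-distribʳ-* m n o)) (interchange m n (m ^ o) (n ^ o))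
  where
  interchange : ∀ a b c d → a * b * (c * d) ≡ a * c * (b * d)
  interchange = solve-∀

^-cancelʳ-≤ : ∀ {m n} o → 0 < o → m ^ o ≤ n ^ o → m ≤ n
^-cancelʳ-≤ {m} {n} o o>0 mᵒ≤nᵒ with m ≤? n
... | yes m≤n = m≤n
... | no  m≰n = contradiction mᵒ≤nᵒ (<⇒≱ (^-monoˡ-< o {{>-nonZero o>0}} (≰⇒> m≰n)))

[1+m]^n≤[1+n]*m^n : ∀ m n → n ≤ m → suc m ^ n ≤ suc n * m ^ n
[1+m]^n≤[1+n]*m^n m zero    _   = s≤s z≤n
[1+m]^n≤[1+n]*m^n m (suc n) n<m = begin
  suc m * suc m ^ n          ≤⟨ *-monoʳ-≤ (suc m) ([1+m]^n≤[1+n]*m^n m n (<⇒≤ n<m)) ⟩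
  suc m * (suc n * m ^ n)    ≡⟨ *-assoc (suc m) (suc n) (m ^ n) ⟨
  suc m * suc n * m ^ n      ≤⟨ *-monoˡ-≤ (m ^ n) factor ⟩
  suc (suc n) * m * m ^ n    ≡⟨ *-assoc (suc (suc n)) m (m ^ n) ⟩
  suc (suc n) * (m * m ^ n)  ∎
  where
  open ≤-Reasoning
  factor : suc m * suc n ≤ suc (suc n) * m
  factor = begin
    suc m * suc n      ≡⟨ expand m n ⟩
    suc n * m + suc n  ≤⟨ +-monoʳ-≤ (suc n * m) n<m ⟩
    suc n * m + m      ≡⟨ +-comm (suc n * m) m ⟩
    suc (suc n) * m    ∎
    where
    expand : ∀ m n → suc m * suc n ≡ suc n * m + suc n
    expand = solve-∀

[1+t+s]^s≤[1+s]^[t+s] : ∀ t s → suc (t + s) ^ s ≤ suc s ^ (t + s)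
[1+t+s]^s≤[1+s]^[t+s] zero    s = ≤-refl
[1+t+s]^s≤[1+s]^[t+s] (suc t) s = begin
  suc (suc t + s) ^ s      ≤⟨ [1+m]^n≤[1+n]*m^n (suc (t + s)) s (≤-trans (m≤n+m s t) (n≤1+n (t + s))) ⟩
  suc s * suc (t + s) ^ s  ≤⟨ *-monoʳ-≤ (suc s) ([1+t+s]^s≤[1+s]^[t+s] t s) ⟩
  suc s * suc s ^ (t + s)  ∎
  where open ≤-Reasoning

q^[q∸1]≤[q∸k]^[q∸1]*q^k : ∀ {q k} → k < q → q ^ (q ∸ 1) ≤ (q ∸ k) ^ (q ∸ 1) * q ^ k
q^[q∸1]≤[q∸k]^[q∸1]*q^k {k = k} k<q with s , refl ← m≤n⇒∃[o]m+o≡n k<q = begin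
  q ^ (k + s)              ≡⟨ ^-distribˡ-+-* q k s ⟩
  q ^ k * q ^ s            ≤⟨ *-monoʳ-≤ (q ^ k) ([1+t+s]^s≤[1+s]^[t+s] k s) ⟩
  q ^ k * suc s ^ (k + s)  ≡⟨ *-comm (q ^ k) _ ⟩
  suc s ^ (k + s) * q ^ k  ≡⟨ cong (λ c → c ^ (k + s) * q ^ k) q∸k≡1+s ⟨
  (q ∸ k) ^ (k + s) * q ^ k ∎
  where
  open ≤-Reasoning
  q = suc (k + s)
  q∸k≡1+s : q ∸ k ≡ suc s
  q∸k≡1+s = trans (cong (_∸ k) (sym (+-suc k s))) (m+n∸m≡n k (suc s))

-- The induction step of nonzeros-bound below: k is the index of the top slice, M and N count nonzeros.
nonzeros-bound-step : ∀ {q k M N n D} → k < q → k ≤ D → (q ∸ k) * M ≤ N →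
                      q ^ ((q ∸ 1) * n) ≤ M ^ (q ∸ 1) * q ^ (D ∸ k) →
                      q ^ ((q ∸ 1) * suc n) ≤ N ^ (q ∸ 1) * q ^ D
nonzeros-bound-step {q} {k} {M} {N} {n} {D} k<q k≤D cM≤N IH = begin
  q ^ (e * suc n)                        ≡⟨ cong (q ^_) (*-suc e n) ⟩
  q ^ (e + e * n)                        ≡⟨ ^-distribˡ-+-* q e (e * n) ⟩
  q ^ e * q ^ (e * n)                    ≤⟨ *-mono-≤ (q^[q∸1]≤[q∸k]^[q∸1]*q^k k<q) IH ⟩
  c ^ e * q ^ k * (M ^ e * q ^ (D ∸ k))  ≡⟨ regroup (c ^ e) (q ^ k) (M ^ e) (q ^ (D ∸ k)) ⟩
  c ^ e * M ^ e * (q ^ k * q ^ (D ∸ k))  ≡⟨ cong₂ _*_ (^-distribʳ-* c M e) (^-distribˡ-+-* q k (D ∸ k)) ⟨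
  (c * M) ^ e * q ^ (k + (D ∸ k))        ≡⟨ cong (λ u → (c * M) ^ e * q ^ u) (m+[n∸m]≡n k≤D) ⟩
  (c * M) ^ e * q ^ D                    ≤⟨ *-monoˡ-≤ (q ^ D) (^-monoˡ-≤ e cM≤N) ⟩
  N ^ e * q ^ D                          ∎
  where
  open ≤-Reasoning
  e = q ∸ 1
  c = q ∸ k
  regroup : ∀ a b c d → a * b * (c * d) ≡ a * c * (b * d)
  regroup = solve-∀

2≤q : ∀ {q} → FiniteField q → 2 ≤ q
2≤q {zero} F = contradiction (Inverse.from enum 0#) λ ()
  where open FiniteField F
2≤q {suc zero} F = contradiction 1≡0 1≢0
  where
  open FiniteField F
  open Inverse enum
  1≡0 : 1# ≡ 0#
  1≡0 = trans (sym (strictlyInverseˡ 1#))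
              (trans (cong to (Fin1-unique (from 1#) (from 0#))) (strictlyInverseˡ 0#))
    where
    Fin1-unique : ∀ (i j : Fin 1) → i ≡ j
    Fin1-unique Fin.zero Fin.zero = refl
2≤q {suc (suc q)} F = s≤s (s≤s z≤n)

module FieldProperties {q : ℕ} (F : FiniteField q) where

  open FiniteField F public renaming (_+_ to _+ᶠ_; _*_ to _*ᶠ_; -_ to -ᶠ_; _^_ to _^ᶠ_)

  ring : CommutativeRing 0ℓ 0ℓ
  ring = record { isCommutativeRing = isCommutativeRing }

  module R = CommutativeRing ring
  open import Algebra.Properties.Group R.+-group using (x∙y⁻¹≈ε⇒x≈y)
  open import Algebra.Solver.Ring.NaturalCoefficients R.commutativeSemiring (λ _ _ → nothing) public
    using (solve; _:+_; _:*_; _:=_; con)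

  instance
    q-nonZero : NonZero q
    q-nonZero = >-nonZero (≤-trans (s≤s z≤n) (2≤q F))

    q∸1-nonZero : NonZero (q ∸ 1)
    q∸1-nonZero = >-nonZero (∸-monoˡ-≤ 1 (2≤q F))

  q≡1+[q∸1] : q ≡ suc (q ∸ 1)
  q≡1+[q∸1] = sym (m+[n∸m]≡n (≤-trans (s≤s z≤n) (2≤q F)))

  x-y≡0⇒x≡y : ∀ {x y} → x +ᶠ -ᶠ y ≡ 0# → x ≡ y
  x-y≡0⇒x≡y = x∙y⁻¹≈ε⇒x≈y _ _

  inverse-cancelˡ : ∀ {x} (x≢0 : x ≢ 0#) y → proj₁ (inverse x x≢0) *ᶠ (x *ᶠ y) ≡ y
  inverse-cancelˡ {x} x≢0 y with inverse x x≢0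
  ... | x⁻¹ , xx⁻¹≡1 = begin
    x⁻¹ *ᶠ (x *ᶠ y)  ≡⟨ solve 3 (λ x x⁻¹ y → x⁻¹ :* (x :* y) := (x :* x⁻¹) :* y) refl x x⁻¹ y ⟩
    (x *ᶠ x⁻¹) *ᶠ y  ≡⟨ cong (_*ᶠ y) xx⁻¹≡1 ⟩
    1# *ᶠ y          ≡⟨ R.*-identityˡ y ⟩
    y                ∎
    where open ≡-Reasoning

  inverse-cancelʳ : ∀ {x} (x≢0 : x ≢ 0#) y → x *ᶠ (proj₁ (inverse x x≢0) *ᶠ y) ≡ y
  inverse-cancelʳ {x} x≢0 y with inverse x x≢0
  ... | x⁻¹ , xx⁻¹≡1 = trans (sym (R.*-assoc x x⁻¹ y)) (trans (cong (_*ᶠ y) xx⁻¹≡1) (R.*-identityˡ y))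

  *-cancelˡ-≢0 : ∀ {x y z} → x ≢ 0# → x *ᶠ y ≡ x *ᶠ z → y ≡ z
  *-cancelˡ-≢0 {x} {y} {z} x≢0 xy≡xz = begin
    y                                    ≡⟨ inverse-cancelˡ x≢0 y ⟨
    proj₁ (inverse x x≢0) *ᶠ (x *ᶠ y)  ≡⟨ cong (proj₁ (inverse x x≢0) *ᶠ_) xy≡xz ⟩
    proj₁ (inverse x x≢0) *ᶠ (x *ᶠ z)  ≡⟨ inverse-cancelˡ x≢0 z ⟩
    z                                    ∎
    where open ≡-Reasoning

  *-cancelʳ-≢0 : ∀ {x y z} → z ≢ 0# → x *ᶠ z ≡ y *ᶠ z → x ≡ y
  *-cancelʳ-≢0 {x} {y} {z} z≢0 xz≡yz = *-cancelˡ-≢0 z≢0 (trans (R.*-comm z x) (trans xz≡yz (R.*-comm y z)))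

  *-≢0 : ∀ {x y} → x ≢ 0# → y ≢ 0# → x *ᶠ y ≢ 0#
  *-≢0 {x} x≢0 y≢0 xy≡0 = y≢0 (*-cancelˡ-≢0 x≢0 (trans xy≡0 (sym (R.zeroʳ x))))

  elements-complete : ∀ x → x ∈ elements
  elements-complete x = subst (_∈ elements) (strictlyInverseˡ x) (∈-map⁺ to (∈-allFin (from x)))
    where open Inverse enum

  elements-unique : Unique elements
  elements-unique = Unique.map⁺ to-injective (Unique.allFin⁺ q)
    where
    open Inverse enum
    to-injective : ∀ {i j} → to i ≡ to j → i ≡ j
    to-injective {i} {j} eq = trans (sym (strictlyInverseʳ i)) (trans (cong from eq) (strictlyInverseʳ j))

  length-elements : length elements ≡ q
  length-elements = trans (length-map _ (allFin q)) (length-tabulate _)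

  nonzero? : (x : Carrier) → Dec (x ≢ 0#)
  nonzero? x = ¬? (x ≟ 0#)

  nonzero : Carrier → Bool
  nonzero x = does (nonzero? x)

  q≡1+#nonzero : q ≡ suc (count nonzero elements)
  q≡1+#nonzero = ≤-antisym
    (begin
      q                               ≡⟨ length-elements ⟨
      length elements                 ≡⟨ count-all (λ _ → refl) elements ⟨
      count (λ _ → true) elements     ≤⟨ count-≤-suc 0# zero-or-nonzero elements-unique ⟩
      suc (count nonzero elements)    ∎)
    (subst (suc (count nonzero elements) ≤_) length-elements
      (count<length (elements-complete 0#) (dec-false (nonzero? 0#) λ 0≢0 → 0≢0 refl)))
    where
    open ≤-Reasoning
    zero-or-nonzero : ∀ x → true ≡ true → x ≡ 0# ⊎ nonzero x ≡ true
    zero-or-nonzero x _ with x ≟ 0#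
    ... | yes x≡0 = inj₁ x≡0
    ... | no  _   = inj₂ refl

  product : List Carrier → Carrier
  product = foldr _*ᶠ_ 1#

  product-↭ : ∀ {xs ys} → xs ↭ ys → product xs ≡ product ys
  product-↭ xs↭ys = foldr-commMonoid R.setoid R.*-isCommutativeMonoid (↭⇒↭ₛ xs↭ys)

  product-map-* : ∀ z xs → product (map (z *ᶠ_) xs) ≡ z ^ᶠ length xs *ᶠ product xs
  product-map-* z []       = sym (R.*-identityʳ 1#)
  product-map-* z (x ∷ xs) = trans (cong (z *ᶠ x *ᶠ_) (product-map-* z xs))
    (solve 4 (λ z x zⁿ p → z :* x :* (zⁿ :* p) := z :* zⁿ :* (x :* p)) refl
             z x (z ^ᶠ length xs) (product xs))

  product-≢0 : ∀ {xs} → All (_≢ 0#) xs → product xs ≢ 0#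
  product-≢0 []             = 1≢0
  product-≢0 (x≢0 ∷ xs≢0) = *-≢0 x≢0 (product-≢0 xs≢0)

  units : List Carrier
  units = filter nonzero? elements

  units-≢0 : ∀ {x} → x ∈ units → x ≢ 0#
  units-≢0 x∈units = proj₂ (∈-filter⁻ nonzero? {xs = elements} x∈units)

  ≢0⇒∈units : ∀ {x} → x ≢ 0# → x ∈ units
  ≢0⇒∈units {x} = ∈-filter⁺ nonzero? (elements-complete x)

  length-units : length units ≡ q ∸ 1
  length-units = trans (length-filter≡count nonzero? elements) (cong (_∸ 1) (sym q≡1+#nonzero))

  map-*-units↭units : ∀ {z} → z ≢ 0# → map (z *ᶠ_) units ↭ units
  map-*-units↭units {z} z≢0 = ∼bag⇒↭ (unique∧set⇒bag
    (Unique.map⁺ (*-cancelˡ-≢0 z≢0) units-unique) units-unique (mk⇔ into onto))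
    where
    units-unique : Unique units
    units-unique = Unique.filter⁺ nonzero? elements-unique
    into : ∀ {y} → y ∈ map (z *ᶠ_) units → y ∈ units
    into y∈ with x , x∈units , refl ← ∈-map⁻ (z *ᶠ_) y∈ = ≢0⇒∈units (*-≢0 z≢0 (units-≢0 x∈units))
    onto : ∀ {y} → y ∈ units → y ∈ map (z *ᶠ_) units
    onto {y} y∈units =
      subst (_∈ map (z *ᶠ_) units) (inverse-cancelʳ z≢0 y) (∈-map⁺ (z *ᶠ_) (≢0⇒∈units z⁻¹y≢0))
      where
      z⁻¹y≢0 : proj₁ (inverse z z≢0) *ᶠ y ≢ 0#
      z⁻¹y≢0 z⁻¹y≡0 = units-≢0 y∈units
        (trans (sym (inverse-cancelʳ z≢0 y)) (trans (cong (z *ᶠ_) z⁻¹y≡0) (R.zeroʳ z)))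

  fermat : ∀ {z} → z ≢ 0# → z ^ᶠ (q ∸ 1) ≡ 1#
  fermat {z} z≢0 = *-cancelˡ-≢0 (product-≢0 (All.tabulate units-≢0)) (begin
    P *ᶠ z ^ᶠ (q ∸ 1)            ≡⟨ R.*-comm P _ ⟩
    z ^ᶠ (q ∸ 1) *ᶠ P            ≡⟨ cong (λ n → z ^ᶠ n *ᶠ P) length-units ⟨
    z ^ᶠ length units *ᶠ P       ≡⟨ product-map-* z units ⟨
    product (map (z *ᶠ_) units)  ≡⟨ product-↭ (map-*-units↭units z≢0) ⟩
    P                            ≡⟨ R.*-identityʳ P ⟨
    P *ᶠ 1#                      ∎)
    where
    open ≡-Reasoning
    P = product units

  0^[q∸1]≡0 : 0# ^ᶠ (q ∸ 1) ≡ 0#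
  0^[q∸1]≡0 = subst (λ k → 0# ^ᶠ k ≡ 0#) (suc-pred (q ∸ 1)) (R.zeroˡ _)

  x^q≡x : ∀ x → x ^ᶠ q ≡ x
  x^q≡x x with x ≟ 0#
  ... | yes refl = trans (cong (0# ^ᶠ_) q≡1+[q∸1]) (R.zeroˡ _)
  ... | no  x≢0  = trans (cong (x ^ᶠ_) q≡1+[q∸1]) (trans (cong (x *ᶠ_) (fermat x≢0)) (R.*-identityʳ x))

  nonzero⇒≢0 : ∀ {x} → nonzero x ≡ true → x ≢ 0#
  nonzero⇒≢0 {x} _ with x ≟ 0#
  nonzero⇒≢0 () | yes _
  ... | no x≢0 = x≢0

  ≢0⇒nonzero : ∀ {x} → x ≢ 0# → nonzero x ≡ true
  ≢0⇒nonzero {x} = dec-true (nonzero? x)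

module Univariate {q : ℕ} (F : FiniteField q) where

  open FieldProperties F

  horner : List Carrier → Carrier → Carrier
  horner []       x = 0#
  horner (c ∷ cs) x = c +ᶠ x *ᶠ horner cs x

  horner-[c] : ∀ c x → horner [ c ] x ≡ c
  horner-[c] c x = trans (cong (c +ᶠ_) (R.zeroʳ x)) (R.+-identityʳ c)

  -- Synthetic division of  a ∷ cs ++ [ c ]  by  x - r : the low coefficients of the quotient,
  -- whose leading coefficient is again c.
  quotient : Carrier → Carrier → List Carrier → Carrier → List Carrier
  quotient r a []       c = []
  quotient r a (b ∷ cs) c = horner (b ∷ cs ++ [ c ]) r ∷ quotient r b cs c

  length-quotient : ∀ r a cs c → length (quotient r a cs c) ≡ length cs
  length-quotient r a []       c = refl
  length-quotient r a (b ∷ cs) c = cong suc (length-quotient r b cs c)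

  -- p(x) = (x - r) Q(x) + p(r), with both sides moved so that no subtraction occurs.
  horner-quotient : ∀ r a cs c x →
    let p = a ∷ cs ++ [ c ]; Q = quotient r a cs c ++ [ c ] in
    horner p x +ᶠ r *ᶠ horner Q x ≡ x *ᶠ horner Q x +ᶠ horner p r
  horner-quotient r a [] c x rewrite horner-[c] c x | horner-[c] c r =
    solve 4 (λ a c x r → a :+ x :* c :+ r :* c := x :* c :+ (a :+ r :* c)) refl a c x r
  horner-quotient r a (b ∷ cs) c x = begin
    a +ᶠ x *ᶠ P x +ᶠ r *ᶠ (P r +ᶠ x *ᶠ Q x)      ≡⟨ regroup a x (P x) r (P r) (Q x) ⟩
    a +ᶠ r *ᶠ P r +ᶠ x *ᶠ (P x +ᶠ r *ᶠ Q x)      ≡⟨ cong (λ t → a +ᶠ r *ᶠ P r +ᶠ x *ᶠ t)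
                                                          (horner-quotient r b cs c x) ⟩
    a +ᶠ r *ᶠ P r +ᶠ x *ᶠ (x *ᶠ Q x +ᶠ P r)      ≡⟨ regroup′ a x (P r) r (Q x) ⟩
    x *ᶠ (P r +ᶠ x *ᶠ Q x) +ᶠ (a +ᶠ r *ᶠ P r)    ∎
    where
    open ≡-Reasoning
    P = horner (b ∷ cs ++ [ c ])
    Q = horner (quotient r b cs c ++ [ c ])
    regroup : ∀ a x Px r Pr Qx →
              a +ᶠ x *ᶠ Px +ᶠ r *ᶠ (Pr +ᶠ x *ᶠ Qx) ≡ a +ᶠ r *ᶠ Pr +ᶠ x *ᶠ (Px +ᶠ r *ᶠ Qx)
    regroup = solve 6 (λ a x Px r Pr Qx →
      a :+ x :* Px :+ r :* (Pr :+ x :* Qx) := a :+ r :* Pr :+ x :* (Px :+ r :* Qx)) refl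
    regroup′ : ∀ a x Pr r Qx →
               a +ᶠ r *ᶠ Pr +ᶠ x *ᶠ (x *ᶠ Qx +ᶠ Pr) ≡ x *ᶠ (Pr +ᶠ x *ᶠ Qx) +ᶠ (a +ᶠ r *ᶠ Pr)
    regroup′ = solve 5 (λ a x Pr r Qx →
      a :+ r :* Pr :+ x :* (x :* Qx :+ Pr) := x :* (Pr :+ x :* Qx) :+ (a :+ r :* Pr)) refl

  all-nonroots : ∀ {p} → (∀ x → p x ≢ 0#) → count (nonzero ∘ p) elements ≡ q
  all-nonroots p≢0 = trans (count-all (λ x → ≢0⇒nonzero (p≢0 x)) elements) length-elements

  nonroots-≥ : ∀ k cs c → length cs ≡ k → c ≢ 0# →
               q ∸ k ≤ count (nonzero ∘ horner (cs ++ [ c ])) elements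
  nonroots-≥ zero [] c refl c≢0 =
    ≤-reflexive (sym (all-nonroots λ x → subst (_≢ 0#) (sym (horner-[c] c x)) c≢0))
  nonroots-≥ (suc k) (a ∷ cs) c len c≢0 with any? (λ r → horner (a ∷ cs ++ [ c ]) r ≟ 0#) elements
  ... | no noRoot = ≤-trans (m∸n≤m q (suc k))
                      (≤-reflexive (sym (all-nonroots λ x px≡0 → noRoot (lose (elements-complete x) px≡0))))
  ... | yes root with r , pr≡0 ← satisfied root = begin
    q ∸ suc k                    ≡⟨ pred[m∸n]≡m∸[1+n] q k ⟨
    pred (q ∸ k)                 ≤⟨ pred-mono-≤ (≤-trans IH (count-≤-suc r cover elements-unique)) ⟩
    count (nonzero ∘ p) elements ∎
    where
    open ≤-Reasoning
    p = horner (a ∷ cs ++ [ c ])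
    Q = horner (quotient r a cs c ++ [ c ])
    IH : q ∸ k ≤ count (nonzero ∘ Q) elements
    IH = nonroots-≥ k (quotient r a cs c) c (trans (length-quotient r a cs c) (suc-injective len)) c≢0
    root-of-p-and-Q : ∀ {x} → p x ≡ 0# → r *ᶠ Q x ≡ x *ᶠ Q x
    root-of-p-and-Q {x} px≡0 = ≡.begin
      r *ᶠ Q x               ≡.≡⟨ R.+-identityˡ _ ⟨
      0# +ᶠ r *ᶠ Q x         ≡.≡⟨ cong (_+ᶠ r *ᶠ Q x) px≡0 ⟨
      p x +ᶠ r *ᶠ Q x        ≡.≡⟨ horner-quotient r a cs c x ⟩
      x *ᶠ Q x +ᶠ p r        ≡.≡⟨ cong (x *ᶠ Q x +ᶠ_) pr≡0 ⟩
      x *ᶠ Q x +ᶠ 0#         ≡.≡⟨ R.+-identityʳ _ ⟩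
      x *ᶠ Q x               ≡.∎
      where module ≡ = ≡-Reasoning
    cover : ∀ x → nonzero (Q x) ≡ true → x ≡ r ⊎ nonzero (p x) ≡ true
    cover x Qx≢0 with x ≟ r
    ... | yes x≡r = inj₁ x≡r
    ... | no  x≢r = inj₂ (≢0⇒nonzero λ px≡0 →
                      x≢r (sym (*-cancelʳ-≢0 (nonzero⇒≢0 Qx≢0) (root-of-p-and-Q px≡0))))

module PolynomialArithmetic {q : ℕ} (F : FiniteField q) where

  open FieldProperties F

  DegreeAtMost : ∀ {n} → ℕ → Poly n → Set
  DegreeAtMost D = All (λ t → totalDeg (proj₂ t) ≤ D)

  constant : ∀ {n} → Carrier → Poly n
  constant {n} c = [ (c , Vec.replicate n 0) ]

  infixl 7 _*ₜ_ _*ₚ_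
  infixr 8 _^ₚ_

  _*ₜ_ : ∀ {n} → Carrier × Vec ℕ n → Carrier × Vec ℕ n → Carrier × Vec ℕ n
  (c , e) *ₜ (c′ , e′) = (c *ᶠ c′ , zipWith _+_ e e′)

  _*ₚ_ : ∀ {n} → Poly n → Poly n → Poly n
  p *ₚ r = concatMap (λ t → map (t *ₜ_) r) p

  _^ₚ_ : ∀ {n} → Poly n → ℕ → Poly n
  p ^ₚ zero  = constant 1#
  p ^ₚ suc k = p *ₚ (p ^ₚ k)

  ^ᶠ-+ : ∀ x m n → x ^ᶠ (m + n) ≡ x ^ᶠ m *ᶠ x ^ᶠ n
  ^ᶠ-+ x zero    n = sym (R.*-identityˡ _)
  ^ᶠ-+ x (suc m) n = trans (cong (x *ᶠ_) (^ᶠ-+ x m n)) (sym (R.*-assoc x _ _))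

  monomial-zeros : ∀ {n} (a : Vec Carrier n) → monomial (Vec.replicate n 0) a ≡ 1#
  monomial-zeros []       = refl
  monomial-zeros (x ∷ a) = trans (R.*-identityˡ _) (monomial-zeros a)

  monomial-+ : ∀ {n} (e e′ : Vec ℕ n) a → monomial (zipWith _+_ e e′) a ≡ monomial e a *ᶠ monomial e′ a
  monomial-+ []       []         []       = sym (R.*-identityˡ 1#)
  monomial-+ (k ∷ e) (k′ ∷ e′) (x ∷ a) =
    trans (cong₂ _*ᶠ_ (^ᶠ-+ x k k′) (monomial-+ e e′ a)) (interchange (x ^ᶠ k) (x ^ᶠ k′) _ _)
    where
    interchange : ∀ a b c d → a *ᶠ b *ᶠ (c *ᶠ d) ≡ a *ᶠ c *ᶠ (b *ᶠ d)
    interchange = solve 4 (λ a b c d → a :* b :* (c :* d) := a :* c :* (b :* d)) refl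

  eval-++ : ∀ {n} (p r : Poly n) a → eval (p ++ r) a ≡ eval p a +ᶠ eval r a
  eval-++ []             r a = sym (R.+-identityˡ _)
  eval-++ ((c , e) ∷ p) r a = trans (cong (c *ᶠ monomial e a +ᶠ_) (eval-++ p r a)) (sym (R.+-assoc _ _ _))

  eval-constant : ∀ {n} c (a : Vec Carrier n) → eval (constant c) a ≡ c
  eval-constant c a = trans (R.+-identityʳ _) (trans (cong (c *ᶠ_) (monomial-zeros a)) (R.*-identityʳ c))

  eval-* : ∀ {n} (p r : Poly n) a → eval (p *ₚ r) a ≡ eval p a *ᶠ eval r a
  eval-* []             r a = sym (R.zeroˡ _)
  eval-* ((c , e) ∷ p) r a = begin
    eval (cr ++ p *ₚ r) a                                   ≡⟨ eval-++ cr (p *ₚ r) a ⟩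
    eval cr a +ᶠ eval (p *ₚ r) a                            ≡⟨ cong₂ _+ᶠ_ (eval-term* r) (eval-* p r a) ⟩
    c *ᶠ monomial e a *ᶠ eval r a +ᶠ eval p a *ᶠ eval r a  ≡⟨ R.distribʳ _ _ _ ⟨
    (c *ᶠ monomial e a +ᶠ eval p a) *ᶠ eval r a            ∎
    where
    open ≡-Reasoning
    cr = map ((c , e) *ₜ_) r
    eval-term* : ∀ r → eval (map ((c , e) *ₜ_) r) a ≡ c *ᶠ monomial e a *ᶠ eval r a
    eval-term* []               = sym (R.zeroʳ _)
    eval-term* ((c′ , e′) ∷ r) = begin
      c *ᶠ c′ *ᶠ monomial (zipWith _+_ e e′) a +ᶠ eval (map ((c , e) *ₜ_) r) a
        ≡⟨ cong₂ (λ m t → c *ᶠ c′ *ᶠ m +ᶠ t) (monomial-+ e e′ a) (eval-term* r) ⟩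
      c *ᶠ c′ *ᶠ (monomial e a *ᶠ monomial e′ a) +ᶠ c *ᶠ monomial e a *ᶠ eval r a
        ≡⟨ distribute c c′ (monomial e a) (monomial e′ a) (eval r a) ⟩
      c *ᶠ monomial e a *ᶠ (c′ *ᶠ monomial e′ a +ᶠ eval r a)
        ∎
      where
      distribute : ∀ c c′ m m′ r → c *ᶠ c′ *ᶠ (m *ᶠ m′) +ᶠ c *ᶠ m *ᶠ r ≡ c *ᶠ m *ᶠ (c′ *ᶠ m′ +ᶠ r)
      distribute = solve 5 (λ c c′ m m′ r →
        c :* c′ :* (m :* m′) :+ c :* m :* r := c :* m :* (c′ :* m′ :+ r)) refl

  eval-^ : ∀ {n} (p : Poly n) k a → eval (p ^ₚ k) a ≡ eval p a ^ᶠ k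
  eval-^ p zero    a = eval-constant 1# a
  eval-^ p (suc k) a = trans (eval-* p (p ^ₚ k) a) (cong (eval p a *ᶠ_) (eval-^ p k a))

  totalDeg-zeros : ∀ n → totalDeg (Vec.replicate n 0) ≡ 0
  totalDeg-zeros zero    = refl
  totalDeg-zeros (suc n) = totalDeg-zeros n

  totalDeg-+ : ∀ {n} (e e′ : Vec ℕ n) → totalDeg (zipWith _+_ e e′) ≡ totalDeg e + totalDeg e′
  totalDeg-+ []       []         = refl
  totalDeg-+ (k ∷ e) (k′ ∷ e′) =
    trans (cong (k + k′ +_) (totalDeg-+ e e′)) (interchange k k′ (totalDeg e) (totalDeg e′))
    where
    interchange : ∀ a b c d → a + b + (c + d) ≡ a + c + (b + d)
    interchange = solve-∀

  constant-degree : ∀ {n} c D → DegreeAtMost {n} D (constant c)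
  constant-degree {n} c D = subst (_≤ D) (sym (totalDeg-zeros n)) z≤n ∷ []

  *ₚ-degree : ∀ {n D D′} {p r : Poly n} → DegreeAtMost D p → DegreeAtMost D′ r → DegreeAtMost (D + D′) (p *ₚ r)
  *ₚ-degree {p = []}            []        _  = []
  *ₚ-degree {p = (c , e) ∷ p} (e≤ ∷ p≤) r≤ =
    ++⁺ (map⁺ (All.map (λ {(_ , e′)} e′≤ → subst (_≤ _) (sym (totalDeg-+ e e′)) (+-mono-≤ e≤ e′≤)) r≤))
        (*ₚ-degree p≤ r≤)

  ^ₚ-degree : ∀ {n D} {p : Poly n} k → DegreeAtMost D p → DegreeAtMost (k * D) (p ^ₚ k)
  ^ₚ-degree zero    p≤ = constant-degree 1# 0
  ^ₚ-degree (suc k) p≤ = *ₚ-degree p≤ (^ₚ-degree k p≤)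

module Truncation {q : ℕ} (F : FiniteField q) where

  open FieldProperties F
  open PolynomialArithmetic F

  _≟ᵉ_ : ∀ {n} (e e′ : Vec ℕ n) → Dec (e ≡ e′)
  _≟ᵉ_ = ≡-dec ℕ._≟_

  module _ {n} {P : Vec ℕ n → Set} (P? : Decidable P) where

    eval-partition : ∀ g a →
                     eval g a ≡ eval (filter (P? ∘ proj₂) g) a +ᶠ eval (filter (¬? ∘ P? ∘ proj₂) g) a
    eval-partition []             a = sym (R.+-identityˡ 0#)
    eval-partition ((c , e) ∷ g) a with P? e
    ... | yes _ = trans (cong (c *ᶠ monomial e a +ᶠ_) (eval-partition g a)) (sym (R.+-assoc _ _ _))
    ... | no  _ = trans (cong (c *ᶠ monomial e a +ᶠ_) (eval-partition g a)) (swap (c *ᶠ monomial e a) _ _)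
      where
      swap : ∀ x y z → x +ᶠ (y +ᶠ z) ≡ y +ᶠ (x +ᶠ z)
      swap = solve 3 (λ x y z → x :+ (y :+ z) := y :+ (x :+ z)) refl

    coeff-filter-accept : ∀ {m} → P m → ∀ g → coeff (filter (P? ∘ proj₂) g) m ≡ coeff g m
    coeff-filter-accept Pm []             = refl
    coeff-filter-accept {m} Pm ((c , e) ∷ g) with P? e
    ... | yes _ with e ≟ᵉ m
    ...   | yes _ = cong (c +ᶠ_) (coeff-filter-accept Pm g)
    ...   | no  _ = coeff-filter-accept Pm g
    coeff-filter-accept {m} Pm ((c , e) ∷ g) | no ¬Pe with e ≟ᵉ m
    ...   | yes refl = contradiction Pm ¬Pe
    ...   | no  _    = coeff-filter-accept Pm g

    coeff-filter-reject : ∀ {m} → ¬ P m → ∀ g → coeff (filter (P? ∘ proj₂) g) m ≡ 0#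
    coeff-filter-reject ¬Pm []             = refl
    coeff-filter-reject {m} ¬Pm ((c , e) ∷ g) with P? e
    ... | no _ = coeff-filter-reject ¬Pm g
    ... | yes Pe with e ≟ᵉ m
    ...   | yes refl = contradiction Pe ¬Pm
    ...   | no  _    = coeff-filter-reject ¬Pm g

  eval-filter-≡ : ∀ {n} (e : Vec ℕ n) g a →
                  eval (filter ((_≟ᵉ e) ∘ proj₂) g) a ≡ coeff g e *ᶠ monomial e a
  eval-filter-≡ e []              a = sym (R.zeroˡ _)
  eval-filter-≡ e ((c , e′) ∷ g) a with e′ ≟ᵉ e
  ... | yes refl = trans (cong (c *ᶠ monomial e a +ᶠ_) (eval-filter-≡ e g a)) (sym (R.distribʳ _ c _))
  ... | no  _    = eval-filter-≡ e g a

  eval-vanishing : ∀ {n} (g : Poly n) → (∀ m → coeff g m ≡ 0#) → ∀ a → eval g a ≡ 0#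
  eval-vanishing g = go g (wellFounded length <-wellFounded g)
    where
    go : ∀ {n} (g : Poly n) → Acc (_<_ on length) g → (∀ m → coeff g m ≡ 0#) → ∀ a → eval g a ≡ 0#
    go []             _        _        a = refl
    go g@((c , e) ∷ _) (acc rec) coeff≡0 a = begin
      eval g a                                              ≡⟨ eval-partition (_≟ᵉ e) g a ⟩
      eval (filter ((_≟ᵉ e) ∘ proj₂) g) a +ᶠ eval others a  ≡⟨ cong₂ _+ᶠ_ (eval-filter-≡ e g a)
                                                                         (go others (rec shorter) others≡0 a) ⟩
      coeff g e *ᶠ monomial e a +ᶠ 0#                       ≡⟨ cong (λ x → x *ᶠ monomial e a +ᶠ 0#) (coeff≡0 e) ⟩
      0# *ᶠ monomial e a +ᶠ 0#                              ≡⟨ trans (R.+-identityʳ _) (R.zeroˡ _) ⟩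
      0#                                                    ∎
      where
      open ≡-Reasoning
      others = filter (¬? ∘ (_≟ᵉ e) ∘ proj₂) g
      shorter : length others < length g
      shorter = filter-notAll (¬? ∘ (_≟ᵉ e) ∘ proj₂) g (here λ e≢e → e≢e refl)
      others≡0 : ∀ m → coeff others m ≡ 0#
      others≡0 m with m ≟ᵉ e
      ... | yes m≡e = coeff-filter-reject (¬? ∘ (_≟ᵉ e)) (λ m≢e → m≢e m≡e) g
      ... | no  m≢e = trans (coeff-filter-accept (¬? ∘ (_≟ᵉ e)) m≢e g) (coeff≡0 m)

  truncate : ∀ {n} → ℕ → Poly n → Poly n
  truncate d = filter ((_≤? d) ∘ totalDeg ∘ proj₂)

  truncate-degree : ∀ {n} d (f : Poly n) → DegreeAtMost d (truncate d f)
  truncate-degree d f = all-filter ((_≤? d) ∘ totalDeg ∘ proj₂) f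

  -- Terms of degree above d may occur in f, as long as they cancel.
  eval-truncate : ∀ {n} d (f : Poly n) → (∀ m → coeff f m ≢ 0# → totalDeg m ≤ d) →
                  ∀ a → eval (truncate d f) a ≡ eval f a
  eval-truncate d f deg≤d a = sym (begin
    eval f a                                   ≡⟨ eval-partition ((_≤? d) ∘ totalDeg) f a ⟩
    eval (truncate d f) a +ᶠ eval excess a     ≡⟨ cong (eval (truncate d f) a +ᶠ_)
                                                       (eval-vanishing excess excess≡0 a) ⟩
    eval (truncate d f) a +ᶠ 0#                ≡⟨ R.+-identityʳ _ ⟩
    eval (truncate d f) a                      ∎)
    where
    open ≡-Reasoning
    excess = filter (¬? ∘ (_≤? d) ∘ totalDeg ∘ proj₂) f
    excess≡0 : ∀ m → coeff excess m ≡ 0#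
    excess≡0 m with totalDeg m ≤? d
    ... | yes m≤d = coeff-filter-reject (¬? ∘ (_≤? d) ∘ totalDeg) (λ m≰d → m≰d m≤d) f
    ... | no  m≰d with coeff f m ≟ 0#
    ...   | yes fm≡0 = trans (coeff-filter-accept (¬? ∘ (_≤? d) ∘ totalDeg) m≰d f) fm≡0
    ...   | no  fm≢0 = contradiction (deg≤d m fm≢0) m≰d

module ExponentReduction {q : ℕ} (F : FiniteField q) where

  open FieldProperties F
  open PolynomialArithmetic F

  -- Since x^q = x, x^(1+e) only depends on e modulo q - 1.
  reduce : ℕ → ℕ
  reduce zero    = zero
  reduce (suc e) = suc (e % (q ∸ 1))

  reduce<q : ∀ e → reduce e < q
  reduce<q zero    = ≤-trans (s≤s z≤n) (2≤q F)
  reduce<q (suc e) = subst (suc (reduce (suc e)) ≤_) (sym q≡1+[q∸1]) (s≤s (m%n<n e (q ∸ 1)))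

  reduce≤ : ∀ e → reduce e ≤ e
  reduce≤ zero    = z≤n
  reduce≤ (suc e) = s≤s (m%n≤m e (q ∸ 1))

  ^ᶠ-reduce : ∀ x e → x ^ᶠ reduce e ≡ x ^ᶠ e
  ^ᶠ-reduce x zero    = refl
  ^ᶠ-reduce x (suc e) = begin
    x ^ᶠ suc (e % (q ∸ 1))                          ≡⟨ drop-periods (e / (q ∸ 1)) (e % (q ∸ 1)) ⟨
    x ^ᶠ suc (e % (q ∸ 1) + e / (q ∸ 1) * (q ∸ 1))  ≡⟨ cong (λ k → x ^ᶠ suc k) (m≡m%n+[m/n]*n e (q ∸ 1)) ⟨
    x ^ᶠ suc e                                      ∎
    where
    open ≡-Reasoning
    drop-periods : ∀ t r → x ^ᶠ suc (r + t * (q ∸ 1)) ≡ x ^ᶠ suc r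
    drop-periods zero    r = cong (λ k → x ^ᶠ suc k) (+-identityʳ r)
    drop-periods (suc t) r = begin
      x ^ᶠ suc (r + (q ∸ 1 + t * (q ∸ 1)))   ≡⟨ cong (x ^ᶠ_) (trans (regroup r (q ∸ 1) _)
                                                  (cong (_+ (r + t * (q ∸ 1))) (sym q≡1+[q∸1]))) ⟩
      x ^ᶠ (q + (r + t * (q ∸ 1)))           ≡⟨ ^ᶠ-+ x q (r + t * (q ∸ 1)) ⟩
      x ^ᶠ q *ᶠ x ^ᶠ (r + t * (q ∸ 1))       ≡⟨ cong (_*ᶠ x ^ᶠ (r + t * (q ∸ 1))) (x^q≡x x) ⟩
      x ^ᶠ suc (r + t * (q ∸ 1))             ≡⟨ drop-periods t r ⟩
      x ^ᶠ suc r                             ∎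
      where
      regroup : ∀ r a b → suc (r + (a + b)) ≡ suc a + (r + b)
      regroup = solve-∀

module Slices {q : ℕ} (F : FiniteField q) where

  open FieldProperties F
  open Univariate F
  open PolynomialArithmetic F
  open ExponentReduction F

  insertAt : ∀ {n} → ℕ → Carrier × Vec ℕ n → List (Poly n) → List (Poly n)
  insertAt _       t []       = []
  insertAt zero    t (P ∷ Ps) = (t ∷ P) ∷ Ps
  insertAt (suc j) t (P ∷ Ps) = P ∷ insertAt j t Ps

  -- p(x, a) = Σ_{j < q} x^j P_j(a): the term c x^e a^es goes to the slice P_(reduce e) as c a^es.
  slices : ∀ {n} → Poly (suc n) → List (Poly n)
  slices []                  = replicate q []
  slices ((c , e ∷ es) ∷ p) = insertAt (reduce e) (c , es) (slices p)

  length-insertAt : ∀ {n} j t (Ps : List (Poly n)) → length (insertAt j t Ps) ≡ length Ps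
  length-insertAt _       t []       = refl
  length-insertAt zero    t (P ∷ Ps) = refl
  length-insertAt (suc j) t (P ∷ Ps) = cong suc (length-insertAt j t Ps)

  length-slices : ∀ {n} (p : Poly (suc n)) → length (slices p) ≡ q
  length-slices []                  = length-replicate q
  length-slices ((c , e ∷ es) ∷ p) = trans (length-insertAt (reduce e) (c , es) (slices p)) (length-slices p)

  valuesAt : ∀ {n} → Vec Carrier n → List (Poly n) → List Carrier
  valuesAt a = map (λ P → eval P a)

  horner-insertAt : ∀ {n} j c es (Ps : List (Poly n)) x a → j < length Ps →
                    horner (valuesAt a (insertAt j (c , es) Ps)) x
                    ≡ x ^ᶠ j *ᶠ (c *ᶠ monomial es a) +ᶠ horner (valuesAt a Ps) x
  horner-insertAt zero    c es (P ∷ Ps) x a _ =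
    solve 4 (λ t P x H → t :+ P :+ x :* H := con 1 :* t :+ (P :+ x :* H)) refl
            (c *ᶠ monomial es a) (eval P a) x (horner (valuesAt a Ps) x)
  horner-insertAt (suc j) c es (P ∷ Ps) x a (s≤s j<len) =
    trans (cong (λ h → eval P a +ᶠ x *ᶠ h) (horner-insertAt j c es Ps x a j<len))
          (solve 5 (λ P x xʲ t H → P :+ x :* (xʲ :* t :+ H) := x :* xʲ :* t :+ (P :+ x :* H)) refl
                   (eval P a) x (x ^ᶠ j) (c *ᶠ monomial es a) (horner (valuesAt a Ps) x))

  horner-empty : ∀ {n} m x (a : Vec Carrier n) → horner (valuesAt a (replicate m [])) x ≡ 0#
  horner-empty zero    x a = refl
  horner-empty (suc m) x a =
    trans (cong (λ h → 0# +ᶠ x *ᶠ h) (horner-empty m x a)) (trans (R.+-identityˡ _) (R.zeroʳ x))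

  eval-slices : ∀ {n} (p : Poly (suc n)) x a → eval p (x ∷ a) ≡ horner (valuesAt a (slices p)) x
  eval-slices []                  x a = sym (horner-empty q x a)
  eval-slices ((c , e ∷ es) ∷ p) x a = begin
    c *ᶠ (x ^ᶠ e *ᶠ monomial es a) +ᶠ eval p (x ∷ a)
      ≡⟨ cong₂ _+ᶠ_ (move c (x ^ᶠ e) (monomial es a)) (eval-slices p x a) ⟩
    x ^ᶠ e *ᶠ (c *ᶠ monomial es a) +ᶠ horner (valuesAt a (slices p)) x
      ≡⟨ cong (λ y → y *ᶠ (c *ᶠ monomial es a) +ᶠ horner (valuesAt a (slices p)) x) (^ᶠ-reduce x e) ⟨
    x ^ᶠ reduce e *ᶠ (c *ᶠ monomial es a) +ᶠ horner (valuesAt a (slices p)) x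
      ≡⟨ horner-insertAt (reduce e) c es (slices p) x a
                         (subst (reduce e <_) (sym (length-slices p)) (reduce<q e)) ⟨
    horner (valuesAt a (slices ((c , e ∷ es) ∷ p))) x ∎
    where
    open ≡-Reasoning
    move : ∀ c y m → c *ᶠ (y *ᶠ m) ≡ y *ᶠ (c *ᶠ m)
    move = solve 3 (λ c y m → c :* (y :* m) := y :* (c :* m)) refl

  -- The terms of the slice at position i of Ps have degree at most D - (j + i).
  SliceDegrees : ∀ {n} → ℕ → ℕ → List (Poly n) → Set
  SliceDegrees D j []       = ⊤
  SliceDegrees D j (P ∷ Ps) = All (λ t → j + totalDeg (proj₂ t) ≤ D) P × SliceDegrees D (suc j) Ps

  insertAt-degrees : ∀ {n D} j i c (es : Vec ℕ n) Ps → j + (i + totalDeg es) ≤ D →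
                     SliceDegrees D j Ps → SliceDegrees D j (insertAt i (c , es) Ps)
  insertAt-degrees j i       c es []       _  _           = tt
  insertAt-degrees j zero    c es (P ∷ Ps) t≤ (P≤ , Ps≤) = (t≤ ∷ P≤) , Ps≤
  insertAt-degrees {D = D} j (suc i) c es (P ∷ Ps) t≤ (P≤ , Ps≤) =
    P≤ , insertAt-degrees (suc j) i c es Ps (subst (_≤ D) (+-suc j (i + totalDeg es)) t≤) Ps≤

  slices-degrees : ∀ {n D} (p : Poly (suc n)) → DegreeAtMost D p → SliceDegrees D 0 (slices p)
  slices-degrees []                  []          = empty-degrees 0 q
    where
    empty-degrees : ∀ {n D} j m → SliceDegrees {n} D j (replicate m [])
    empty-degrees j zero    = tt
    empty-degrees j (suc m) = [] , empty-degrees (suc j) m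
  slices-degrees ((c , e ∷ es) ∷ p) (t≤ ∷ p≤) =
    insertAt-degrees 0 (reduce e) c es (slices p) (≤-trans (+-monoˡ-≤ (totalDeg es) (reduce≤ e)) t≤)
                     (slices-degrees p p≤)

  slice-degree : ∀ {n D} j pre (P : Poly n) zs → SliceDegrees D j (pre ++ P ∷ zs) →
                 All (λ t → j + length pre + totalDeg (proj₂ t) ≤ D) P
  slice-degree {D = D} j []        P zs (P≤ , _) =
    subst (λ k → All (λ t → k + totalDeg (proj₂ t) ≤ D) P) (sym (+-identityʳ j)) P≤
  slice-degree {D = D} j (_ ∷ pre) P zs (_ , Ps≤) =
    subst (λ k → All (λ t → k + totalDeg (proj₂ t) ≤ D) P) (sym (+-suc j (length pre)))
          (slice-degree (suc j) pre P zs Ps≤)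

module NonzeroCount {q : ℕ} (F : FiniteField q) where

  open FieldProperties F
  open Univariate F
  open PolynomialArithmetic F
  open ExponentReduction F
  open Slices F

  points-complete : ∀ {n} (a : Vec Carrier n) → a ∈ points n
  points-complete []      = here refl
  points-complete (x ∷ a) =
    ∈-concat⁺′ (∈-map⁺ (x ∷_) (points-complete a)) (∈-map⁺ (λ x → map (x ∷_) (points _)) (elements-complete x))

  count-points-suc : ∀ {n} p →
                     count p (points (suc n)) ≡ sum (map (λ a → count (λ x → p (x ∷ a)) elements) (points n))
  count-points-suc {n} p = begin
    count p (concatMap (λ x → map (x ∷_) (points n)) elements)
      ≡⟨ count-concatMap p _ elements ⟩
    sum (map (λ x → count p (map (x ∷_) (points n))) elements)
      ≡⟨ cong sum (map-cong (λ x → count-map p (x ∷_) (points n)) elements) ⟩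
    sum (map (λ x → count (λ a → p (x ∷ a)) (points n)) elements)
      ≡⟨ sum-count-comm (λ x a → p (x ∷ a)) elements (points n) ⟩
    sum (map (λ a → count (λ x → p (x ∷ a)) elements) (points n))
      ∎
    where open ≡-Reasoning

  Nonzero : ∀ {n} → Poly n → Set
  Nonzero {n} p = ∃ λ (a : Vec Carrier n) → eval p a ≢ 0#

  Vanishing : ∀ {n} → Poly n → Set
  Vanishing {n} p = ∀ (a : Vec Carrier n) → eval p a ≡ 0#

  nonzero-or-vanishing : ∀ {n} (p : Poly n) → Nonzero p ⊎ Vanishing p
  nonzero-or-vanishing {n} p with any? (λ a → nonzero? (eval p a)) (points n)
  ... | yes somewhere = inj₁ (satisfied somewhere)
  ... | no  nowhere   = inj₂ λ a → vanishes a
    where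
    vanishes : ∀ a → eval p a ≡ 0#
    vanishes a with eval p a ≟ 0#
    ... | yes pa≡0 = pa≡0
    ... | no  pa≢0 = contradiction (lose (points-complete a) pa≢0) nowhere

  TopSlice : ∀ {n} → List (Poly n) → Set
  TopSlice {n} Ps = Σ (List (Poly n)) λ pre → Σ (Poly n) λ P → Σ (List (Poly n)) λ zs →
                    Ps ≡ pre ++ P ∷ zs × Nonzero P × All Vanishing zs

  topSlice : ∀ {n} (Ps : List (Poly n)) → TopSlice Ps ⊎ All Vanishing Ps
  topSlice []       = inj₂ []
  topSlice (P ∷ Ps) with topSlice Ps
  ... | inj₁ (pre , Q , zs , refl , Q≢0 , zs≡0) = inj₁ (P ∷ pre , Q , zs , refl , Q≢0 , zs≡0)
  ... | inj₂ Ps≡0 with nonzero-or-vanishing P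
  ...   | inj₁ P≢0 = inj₁ ([] , P , Ps , refl , P≢0 , Ps≡0)
  ...   | inj₂ P≡0 = inj₂ (P≡0 ∷ Ps≡0)

  horner-vanishing : ∀ {n} {Ps : List (Poly n)} → All Vanishing Ps → ∀ x a → horner (valuesAt a Ps) x ≡ 0#
  horner-vanishing []            x a = refl
  horner-vanishing (P≡0 ∷ Ps≡0) x a = trans (cong₂ (λ u v → u +ᶠ x *ᶠ v) (P≡0 a) (horner-vanishing Ps≡0 x a))
                                           (trans (R.+-identityˡ _) (R.zeroʳ x))

  horner-topSlice : ∀ {n} pre (P : Poly n) {zs} → All Vanishing zs → ∀ x a →
                    horner (valuesAt a (pre ++ P ∷ zs)) x ≡ horner (valuesAt a pre ++ [ eval P a ]) x
  horner-topSlice []        P zs≡0 x a = cong (λ h → eval P a +ᶠ x *ᶠ h) (horner-vanishing zs≡0 x a)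
  horner-topSlice (Q ∷ pre) P zs≡0 x a = cong (λ h → eval Q a +ᶠ x *ᶠ h) (horner-topSlice pre P zs≡0 x a)

  nonzeros : ∀ {n} → Poly n → ℕ
  nonzeros {n} p = count (nonzero ∘ eval p) (points n)

  -- Wherever the top slice P_k is nonzero, p is a univariate polynomial of degree k in the first variable.
  nonzeros-topSlice : ∀ {n} (p : Poly (suc n)) pre P {zs} → slices p ≡ pre ++ P ∷ zs → All Vanishing zs →
                      (q ∸ length pre) * nonzeros P ≤ nonzeros p
  nonzeros-topSlice {n} p pre P split zs≡0 = begin
    (q ∸ length pre) * nonzeros P  ≤⟨ *-count≤sum (q ∸ length pre) (nonzero ∘ eval P) fibre fibre-bound (points n) ⟩
    sum (map fibre (points n))     ≡⟨ count-points-suc (nonzero ∘ eval p) ⟨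
    nonzeros p                     ∎
    where
    open ≤-Reasoning
    fibre : Vec Carrier n → ℕ
    fibre a = count (λ x → nonzero (eval p (x ∷ a))) elements
    eval-fibre : ∀ a x → eval p (x ∷ a) ≡ horner (valuesAt a pre ++ [ eval P a ]) x
    eval-fibre a x = trans (eval-slices p x a)
                           (trans (cong (λ Ps → horner (valuesAt a Ps) x) split) (horner-topSlice pre P zs≡0 x a))
    fibre-bound : ∀ a → (q ∸ length pre) * indicator (nonzero (eval P a)) ≤ fibre a
    fibre-bound a with eval P a ≟ 0#
    ... | yes _    = subst (_≤ fibre a) (sym (*-zeroʳ (q ∸ length pre))) z≤n
    ... | no  Pa≢0 = subst (_≤ fibre a) (sym (*-identityʳ (q ∸ length pre)))
      (≤-trans (nonroots-≥ (length pre) (valuesAt a pre) (eval P a) (length-map _ pre) Pa≢0)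
               (≤-reflexive (count-cong (λ x → cong nonzero (sym (eval-fibre a x))) elements)))

  offset≤ : ∀ {n j D} {P : Poly n} → All (λ t → j + totalDeg (proj₂ t) ≤ D) P → Nonzero P → j ≤ D
  offset≤ []                  (_ , 0≢0) = contradiction refl 0≢0
  offset≤ {j = j} (j+t≤D ∷ _) _         = m+n≤o⇒m≤o j j+t≤D

  -- nonzeros p ≥ q^(n - D/(q-1)), raised to the power q - 1 to stay within ℕ.
  nonzeros-bound : ∀ n D (p : Poly n) → DegreeAtMost D p → Nonzero p →
                   q ^ ((q ∸ 1) * n) ≤ nonzeros p ^ (q ∸ 1) * q ^ D
  nonzeros-bound zero D p _ ([] , p≢0) = begin
    q ^ ((q ∸ 1) * 0)                 ≡⟨ cong (q ^_) (*-zeroʳ (q ∸ 1)) ⟩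
    1                                 ≤⟨ m^n>0 q D ⟩
    q ^ D                             ≡⟨ *-identityˡ (q ^ D) ⟨
    1 * q ^ D                         ≡⟨ cong (_* q ^ D) (^-zeroˡ (q ∸ 1)) ⟨
    1 ^ (q ∸ 1) * q ^ D               ≡⟨ cong (λ N → N ^ (q ∸ 1) * q ^ D) nonzeros≡1 ⟩
    nonzeros p ^ (q ∸ 1) * q ^ D      ∎
    where
    open ≤-Reasoning
    nonzeros≡1 : 1 ≡ nonzeros p
    nonzeros≡1 = cong (λ b → indicator b + 0) (sym (≢0⇒nonzero p≢0))
  nonzeros-bound (suc n) D p p≤D (x ∷ a , pxa≢0) with topSlice (slices p)
  ... | inj₂ slices≡0 = contradiction (trans (eval-slices p x a) (horner-vanishing slices≡0 x a)) pxa≢0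
  ... | inj₁ (pre , P , zs , split , P≢0 , zs≡0) =
    nonzeros-bound-step k<q k≤D (nonzeros-topSlice p pre P split zs≡0) (nonzeros-bound n (D ∸ k) P P≤D∸k P≢0)
    where
    k = length pre
    offset : All (λ t → k + totalDeg (proj₂ t) ≤ D) P
    offset = slice-degree 0 pre P zs (subst (SliceDegrees D 0) split (slices-degrees p p≤D))
    k≤D : k ≤ D
    k≤D = offset≤ offset P≢0
    P≤D∸k : DegreeAtMost (D ∸ k) P
    P≤D∸k = All.map (λ {t} k+t≤D → m+n≤o⇒m≤o∸n _ (subst (_≤ D) (+-comm k (totalDeg (proj₂ t))) k+t≤D)) offset
    k<q : k < q
    k<q = subst (k <_) (trans (sym (length-++ pre)) (trans (cong length (sym split)) (length-slices p)))
                (m<m+n k (s≤s z≤n))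

module Warning {q : ℕ} (F : FiniteField q) where

  open FieldProperties F
  open PolynomialArithmetic F
  open Truncation F
  open NonzeroCount F

  -- By Fermat, the indicator function of f⁻¹(y).
  fibreIndicator : ∀ {n} → Poly n → Carrier → Poly n
  fibreIndicator f y = constant 1# ++ constant (-ᶠ 1#) *ₚ ((f ++ constant (-ᶠ y)) ^ₚ (q ∸ 1))

  fibreIndicator-degree : ∀ {n d} {f : Poly n} y → DegreeAtMost d f →
                          DegreeAtMost ((q ∸ 1) * d) (fibreIndicator f y)
  fibreIndicator-degree {d = d} y f≤d = ++⁺ (constant-degree 1# _)
    (*ₚ-degree (constant-degree (-ᶠ 1#) 0) (^ₚ-degree (q ∸ 1) (++⁺ f≤d (constant-degree (-ᶠ y) d))))

  eval-fibreIndicator : ∀ {n} (f : Poly n) y a →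
                        eval (fibreIndicator f y) a ≡ 1# +ᶠ -ᶠ 1# *ᶠ (eval f a +ᶠ -ᶠ y) ^ᶠ (q ∸ 1)
  eval-fibreIndicator f y a = begin
    eval (constant 1# ++ constant (-ᶠ 1#) *ₚ h ^ₚ (q ∸ 1)) a
      ≡⟨ eval-++ (constant 1#) (constant (-ᶠ 1#) *ₚ h ^ₚ (q ∸ 1)) a ⟩
    eval (constant 1#) a +ᶠ eval (constant (-ᶠ 1#) *ₚ h ^ₚ (q ∸ 1)) a
      ≡⟨ cong₂ _+ᶠ_ (eval-constant 1# a) (eval-* (constant (-ᶠ 1#)) (h ^ₚ (q ∸ 1)) a) ⟩
    1# +ᶠ eval (constant (-ᶠ 1#)) a *ᶠ eval (h ^ₚ (q ∸ 1)) a
      ≡⟨ cong₂ (λ u v → 1# +ᶠ u *ᶠ v) (eval-constant (-ᶠ 1#) a) (eval-^ h (q ∸ 1) a) ⟩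
    1# +ᶠ -ᶠ 1# *ᶠ eval h a ^ᶠ (q ∸ 1)
      ≡⟨ cong (λ u → 1# +ᶠ -ᶠ 1# *ᶠ u ^ᶠ (q ∸ 1)) eval-h ⟩
    1# +ᶠ -ᶠ 1# *ᶠ (eval f a +ᶠ -ᶠ y) ^ᶠ (q ∸ 1)
      ∎
    where
    open ≡-Reasoning
    h = f ++ constant (-ᶠ y)
    eval-h : eval h a ≡ eval f a +ᶠ -ᶠ y
    eval-h = trans (eval-++ f (constant (-ᶠ y)) a) (cong (eval f a +ᶠ_) (eval-constant (-ᶠ y) a))

  nonzero-fibreIndicator : ∀ {n} (f : Poly n) y a →
                           nonzero (eval (fibreIndicator f y) a) ≡ does (eval f a ≟ y)
  nonzero-fibreIndicator f y a with eval f a ≟ y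
  ... | yes refl = ≢0⇒nonzero (subst (_≢ 0#) (sym on-fibre) 1≢0)
    where
    on-fibre : eval (fibreIndicator f y) a ≡ 1#
    on-fibre = begin
      eval (fibreIndicator f y) a                          ≡⟨ eval-fibreIndicator f y a ⟩
      1# +ᶠ -ᶠ 1# *ᶠ (eval f a +ᶠ -ᶠ eval f a) ^ᶠ (q ∸ 1) ≡⟨ cong (λ u → 1# +ᶠ -ᶠ 1# *ᶠ u ^ᶠ (q ∸ 1))
                                                                (R.-‿inverseʳ (eval f a)) ⟩
      1# +ᶠ -ᶠ 1# *ᶠ 0# ^ᶠ (q ∸ 1)                         ≡⟨ cong (λ u → 1# +ᶠ -ᶠ 1# *ᶠ u) 0^[q∸1]≡0 ⟩
      1# +ᶠ -ᶠ 1# *ᶠ 0#                                    ≡⟨ cong (1# +ᶠ_) (R.zeroʳ _) ⟩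
      1# +ᶠ 0#                                             ≡⟨ R.+-identityʳ 1# ⟩
      1#                                                   ∎
      where open ≡-Reasoning
  ... | no fa≢y = subst (λ v → nonzero v ≡ false) (sym off-fibre) (dec-false (nonzero? 0#) λ 0≢0 → 0≢0 refl)
    where
    off-fibre : eval (fibreIndicator f y) a ≡ 0#
    off-fibre = begin
      eval (fibreIndicator f y) a                    ≡⟨ eval-fibreIndicator f y a ⟩
      1# +ᶠ -ᶠ 1# *ᶠ (eval f a +ᶠ -ᶠ y) ^ᶠ (q ∸ 1)   ≡⟨ cong (λ u → 1# +ᶠ -ᶠ 1# *ᶠ u) (fermat (fa≢y ∘ x-y≡0⇒x≡y)) ⟩
      1# +ᶠ -ᶠ 1# *ᶠ 1#                              ≡⟨ cong (1# +ᶠ_) (R.*-identityʳ _) ⟩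
      1# +ᶠ -ᶠ 1#                                    ≡⟨ R.-‿inverseʳ 1# ⟩
      0#                                             ∎
      where open ≡-Reasoning

  preimageSize-lower-bound : ∀ {n d} (f : Poly n) y → HasDegree f d → 0 < preimageSize f y →
                             q ^ n ≤ preimageSize f y * q ^ d
  preimageSize-lower-bound {n} {d} f y (deg≤d , _) fibre≢∅ = ^-cancelʳ-≤ (q ∸ 1) (>-nonZero⁻¹ (q ∸ 1)) (begin
    (q ^ n) ^ (q ∸ 1)                         ≡⟨ ^-*-assoc q n (q ∸ 1) ⟩
    q ^ (n * (q ∸ 1))                         ≡⟨ cong (q ^_) (*-comm n (q ∸ 1)) ⟩
    q ^ ((q ∸ 1) * n)                         ≤⟨ nonzeros-bound n ((q ∸ 1) * d) g g-degree g≢0 ⟩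
    nonzeros g ^ (q ∸ 1) * q ^ ((q ∸ 1) * d)  ≡⟨ cong₂ (λ N k → N ^ (q ∸ 1) * q ^ k) (sym N≡) (*-comm (q ∸ 1) d) ⟩
    N ^ (q ∸ 1) * q ^ (d * (q ∸ 1))           ≡⟨ cong (N ^ (q ∸ 1) *_) (^-*-assoc q d (q ∸ 1)) ⟨
    N ^ (q ∸ 1) * (q ^ d) ^ (q ∸ 1)           ≡⟨ ^-distribʳ-* N (q ^ d) (q ∸ 1) ⟨
    (N * q ^ d) ^ (q ∸ 1)                     ∎)
    where
    open ≤-Reasoning
    N = preimageSize f y
    g = fibreIndicator (truncate d f) y
    g-degree : DegreeAtMost ((q ∸ 1) * d) g
    g-degree = fibreIndicator-degree y (truncate-degree d f)
    on-fibre : ∀ a → nonzero (eval g a) ≡ does (eval f a ≟ y)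
    on-fibre a = trans (nonzero-fibreIndicator (truncate d f) y a)
                       (cong (λ v → does (v ≟ y)) (eval-truncate d f deg≤d a))
    N≡ : N ≡ nonzeros g
    N≡ = trans (length-filter≡count (λ a → eval f a ≟ y) (points n)) (count-cong (λ a → sym (on-fibre a)) (points n))
    g≢0 : Nonzero g
    g≢0 with a , ga≢0 ← count>0⇒∃ (nonzero ∘ eval g) (points n) (subst (0 <_) N≡ fibre≢∅) = a , nonzero⇒≢0 ga≢0

lemma1p4 : (q : ℕ) (F : FiniteField q) (n d : ℕ) (f : FiniteField.Poly F n) →
           FiniteField.HasDegree F f d →
           (y : FiniteField.Carrier F) →
           0 < FiniteField.preimageSize F f y →
           (a b : ℕ) → 0 < b → q ^ b ≤ 2 ^ a →
           q ^ (n * b) ≤ (FiniteField.preimageSize F f y) ^ b * q ^ (q * a) * q ^ (d * b)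
lemma1p4 q F n d f f-deg y fibre≢∅ a b _ _ = begin
  q ^ (n * b)                       ≡⟨ ^-*-assoc q n b ⟨
  (q ^ n) ^ b                       ≤⟨ ^-monoˡ-≤ b (preimageSize-lower-bound f y f-deg fibre≢∅) ⟩
  (N * q ^ d) ^ b                   ≡⟨ ^-distribʳ-* N (q ^ d) b ⟩
  N ^ b * (q ^ d) ^ b               ≡⟨ cong (N ^ b *_) (^-*-assoc q d b) ⟩
  N ^ b * q ^ (d * b)               ≤⟨ *-monoˡ-≤ (q ^ (d * b)) (m≤m*n (N ^ b) (q ^ (q * a)) {{m^n≢0 q (q * a)}}) ⟩
  N ^ b * q ^ (q * a) * q ^ (d * b) ∎
  where
  open ≤-Reasoning
  open FieldProperties F using (q-nonZero; preimageSize)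
  open Warning F
  N = preimageSize f y
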